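{- Let $m\neq0$ and $r$ be real and let $\alpha_0,\alpha_1,\dots$ be real numbers. Then for all $0\le k\le n$, \[ W_{m,r}(n,k)=\sum_{i=k}^{n}m^{i-k}\,W_{m,r;\overline{\alpha}}(n,i)\,S(i,k;\overline{\alpha}). \]
   Context: Let $(x)_k=x(x-1)\cdots(x-k+1)$, $(x)_0=1$, and for a real sequence $\overline{\alpha}=(\alpha_0,\alpha_1,\dots)$ let $(x;\overline{\alpha})_n=\prod_{i=0}^{n-1}(x-\alpha_i)$, $(x;\overline{\alpha})_0=1$. The $r$-Whitney numbers of the second kind $W_{m,r}(n,k)$ are defined by $(mx+r)^n=\sum_{k=0}^{n}W_{m,r}(n,k)m^k(x)_k$. The multiparameter Stirling numbers of the second kind $S(n,k;\overline{\alpha})$ are defined by $(x;\overline{\alpha})_n=\sum_{k=0}^{n}S(n,k;\overline{\alpha})(x)_k$. The generalized $r$-Whitney numbers of the second kind $W_{m,r;\overline{\alpha}}(n,k)$ are defined by $(mx+r)^n=\sum_{k=0}^{n}W_{m,r;\overline{\alpha}}(n,k)m^k(x;\overline{\alpha})_k$. All identities are polynomial identities in $x$. -}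

module Defs where

open import Level using (_⊔_)
open import Data.Nat using (ℕ; zero; suc; _∸_) renaming (_+_ to _+ℕ_)
open import Algebra.Bundles using (CommutativeRing)
open import Relation.Nullary using (¬_)
open import Data.Product using (∃)

module Over {c ℓ} (R : CommutativeRing c ℓ) where
  open CommutativeRing R hiding (zero)

  IsField : Set (c ⊔ ℓ)
  IsField = (¬ (1# ≈ 0#)) Data.Product.× (∀ a → ¬ (a ≈ 0#) → ∃ λ b → a * b ≈ 1#)

  pow : Carrier → ℕ → Carrier
  pow x zero    = 1#
  pow x (suc n) = x * pow x n

  natR : ℕ → Carrier
  natR zero    = 0#
  natR (suc n) = 1# + natR n

  sumUpTo : ℕ → (ℕ → Carrier) → Carrier
  sumUpTo zero    f = f 0
  sumUpTo (suc n) f = sumUpTo n f + f (suc n)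

  -- Σ_{i=k}^{n} f i  (used only when k ≤ n)
  sumFromTo : ℕ → ℕ → (ℕ → Carrier) → Carrier
  sumFromTo k n f = sumUpTo (n ∸ k) (λ j → f (k +ℕ j))

  -- Polynomials in x over R, as coefficient sequences (coefficient of x^j).
  Poly : Set c
  Poly = ℕ → Carrier

  _≈ₚ_ : Poly → Poly → Set ℓ
  p ≈ₚ q = ∀ j → p j ≈ q j

  constP : Carrier → Poly
  constP a zero    = a
  constP a (suc j) = 0#

  scaleP : Carrier → Poly → Poly
  scaleP a p j = a * p j

  addP : Poly → Poly → Poly
  addP p q j = p j + q j

  sumP : ℕ → (ℕ → Poly) → Poly
  sumP zero    f = f 0
  sumP (suc n) f = addP (sumP n f) (f (suc n))

  -- multiplication by the linear polynomial a x + b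
  mulLin : Carrier → Carrier → Poly → Poly
  mulLin a b p zero    = b * p zero
  mulLin a b p (suc j) = a * p j + b * p (suc j)

  powLin : Carrier → Carrier → ℕ → Poly
  powLin a b zero    = constP 1#
  powLin a b (suc n) = mulLin a b (powLin a b n)

  -- generalized falling factorial (x; α)_k = ∏_{i=0}^{k-1} (x - α_i)
  genFall : (ℕ → Carrier) → ℕ → Poly
  genFall α zero    = constP 1#
  genFall α (suc k) = mulLin 1# (- α k) (genFall α k)

  fall : ℕ → Poly
  fall = genFall natR

  IsRWhitney2 : Carrier → Carrier → (ℕ → ℕ → Carrier) → Set ℓ
  IsRWhitney2 m r W = ∀ n →
    powLin m r n ≈ₚ sumP n (λ k → scaleP (W n k * pow m k) (fall k))

  IsMultiStirling2 : (ℕ → Carrier) → (ℕ → ℕ → Carrier) → Set ℓ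
  IsMultiStirling2 α S = ∀ n →
    genFall α n ≈ₚ sumP n (λ k → scaleP (S n k) (fall k))

  IsGenRWhitney2 : Carrier → Carrier → (ℕ → Carrier) → (ℕ → ℕ → Carrier) → Set ℓ
  IsGenRWhitney2 m r α Wα = ∀ n →
    powLin m r n ≈ₚ sumP n (λ k → scaleP (Wα n k * pow m k) (genFall α k))

-- Substituting the Stirling expansion (x;α)_i = Σ_{k≤i} S(i,k) (x)_k into
-- (mx+r)^n = Σ_i Wα(n,i) m^i (x;α)_i and exchanging the triangular double sum writes
-- (mx+r)^n in the basis (x)_k with coefficients Σ_{i=k}^{n} Wα(n,i) m^i S(i,k).
-- Every basis (x;β)_k is monic and triangular, so coordinates are unique and these
-- coefficients equal W(n,k) m^k; as m^k is invertible, the m^k factors cancel.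
module Submission where

open import Defs
open import Data.Nat using (ℕ; zero; suc; _≤_; _<_; _∸_; z≤n; s≤s) renaming (_+_ to _+ℕ_)
open import Data.Nat.Properties
  using (≤-refl; <-trans; m≤n⇒m≤1+n; m≤n⇒m<n∨m≡n; m<n⇒m<1+n; m≤m+n; m+[n∸m]≡n; +-∸-assoc; n∸n≡0; +-suc)
import Data.Nat.Properties as ℕₚ
open import Algebra.Bundles using (CommutativeRing)
open import Relation.Nullary using (¬_)
open import Data.Sum using (inj₁; inj₂)
open import Data.Product using (_,_; proj₂)
import Relation.Binary.PropositionalEquality as ≡
import Algebra.Properties.Group as GroupProperties
import Algebra.Properties.CommutativeSemigroup as CommutativeSemigroupProperties
import Relation.Binary.Reasoning.Setoid as SetoidReasoning

module _ {c ℓ} (R : CommutativeRing c ℓ) where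
  open CommutativeRing R hiding (zero)
  open Over R
  open SetoidReasoning setoid
  open GroupProperties +-group using (∙-cancelʳ)
  open CommutativeSemigroupProperties +-commutativeSemigroup
    using () renaming (interchange to +-interchange)
  open CommutativeSemigroupProperties *-commutativeSemigroup
    using () renaming (interchange to *-interchange)

  sumUpTo-cong : ∀ n {f g : ℕ → Carrier} → (∀ i → i ≤ n → f i ≈ g i) →
                 sumUpTo n f ≈ sumUpTo n g
  sumUpTo-cong zero    f≈g = f≈g 0 z≤n
  sumUpTo-cong (suc n) f≈g =
    +-cong (sumUpTo-cong n (λ i i≤n → f≈g i (m≤n⇒m≤1+n i≤n))) (f≈g (suc n) ≤-refl)

  sumUpTo-+ : ∀ n (f g : ℕ → Carrier) →
              sumUpTo n (λ i → f i + g i) ≈ sumUpTo n f + sumUpTo n g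
  sumUpTo-+ zero    f g = refl
  sumUpTo-+ (suc n) f g = trans (+-congʳ (sumUpTo-+ n f g)) (+-interchange _ _ _ _)

  *-distribˡ-sumUpTo : ∀ a n (f : ℕ → Carrier) → a * sumUpTo n f ≈ sumUpTo n (λ i → a * f i)
  *-distribˡ-sumUpTo a zero    f = refl
  *-distribˡ-sumUpTo a (suc n) f = trans (distribˡ _ _ _) (+-congʳ (*-distribˡ-sumUpTo a n f))

  *-distribʳ-sumUpTo : ∀ a n (f : ℕ → Carrier) → sumUpTo n f * a ≈ sumUpTo n (λ i → f i * a)
  *-distribʳ-sumUpTo a zero    f = refl
  *-distribʳ-sumUpTo a (suc n) f = trans (distribʳ _ _ _) (+-congʳ (*-distribʳ-sumUpTo a n f))

  sumFromTo-cong : ∀ k n {f g : ℕ → Carrier} → (∀ i → k ≤ i → f i ≈ g i) →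
                   sumFromTo k n f ≈ sumFromTo k n g
  sumFromTo-cong k n f≈g = sumUpTo-cong (n ∸ k) (λ j _ → f≈g (k +ℕ j) (m≤m+n k j))

  sumFromTo-self : ∀ n (f : ℕ → Carrier) → sumFromTo n n f ≈ f n
  sumFromTo-self n f rewrite n∸n≡0 n | ℕₚ.+-identityʳ n = refl

  sumFromTo-extendʳ : ∀ {k n} (f : ℕ → Carrier) → k ≤ n →
                      sumFromTo k (suc n) f ≈ sumFromTo k n f + f (suc n)
  sumFromTo-extendʳ {k} {n} f k≤n rewrite +-∸-assoc 1 k≤n =
    +-congˡ (reflexive (≡.cong f (≡.trans (+-suc k (n ∸ k)) (≡.cong suc (m+[n∸m]≡n k≤n)))))

  sumUpTo-triangle : ∀ n (f : ℕ → ℕ → Carrier) →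
    sumUpTo n (λ i → sumUpTo i (f i)) ≈ sumUpTo n (λ k → sumFromTo k n (λ i → f i k))
  sumUpTo-triangle zero    f = refl
  sumUpTo-triangle (suc n) f = begin
    sumUpTo n (λ i → sumUpTo i (f i)) + (sumUpTo n (f (suc n)) + f (suc n) (suc n))
      ≈⟨ +-congʳ (sumUpTo-triangle n f) ⟩
    sumUpTo n (λ k → sumFromTo k n (λ i → f i k)) + (sumUpTo n (f (suc n)) + f (suc n) (suc n))
      ≈⟨ sym (+-assoc _ _ _) ⟩
    sumUpTo n (λ k → sumFromTo k n (λ i → f i k)) + sumUpTo n (f (suc n)) + f (suc n) (suc n)
      ≈⟨ +-cong (sym (sumUpTo-+ n _ _)) (sym (sumFromTo-self (suc n) (λ i → f i (suc n)))) ⟩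
    sumUpTo n (λ k → sumFromTo k n (λ i → f i k) + f (suc n) k)
      + sumFromTo (suc n) (suc n) (λ i → f i (suc n))
      ≈⟨ +-congʳ (sumUpTo-cong n (λ k k≤n → sym (sumFromTo-extendʳ (λ i → f i k) k≤n))) ⟩
    sumUpTo (suc n) (λ k → sumFromTo k (suc n) (λ i → f i k)) ∎

  pow-+ : ∀ x i j → pow x (i +ℕ j) ≈ pow x i * pow x j
  pow-+ x zero    j = sym (*-identityˡ _)
  pow-+ x (suc i) j = trans (*-congˡ (pow-+ x i j)) (sym (*-assoc _ _ _))

  pow-split : ∀ x {k i} → k ≤ i → pow x i ≈ pow x k * pow x (i ∸ k)
  pow-split x {k} {i} k≤i =
    trans (reflexive (≡.cong (pow x) (≡.sym (m+[n∸m]≡n k≤i)))) (pow-+ x k (i ∸ k))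

  pow-inverse : ∀ {x y} k → x * y ≈ 1# → pow x k * pow y k ≈ 1#
  pow-inverse zero    xy≈1 = *-identityˡ 1#
  pow-inverse (suc k) xy≈1 =
    trans (*-interchange _ _ _ _) (trans (*-cong xy≈1 (pow-inverse k xy≈1)) (*-identityˡ 1#))

  *-cancelˡ-invertible : ∀ {a b x y} → a * b ≈ 1# → a * x ≈ a * y → x ≈ y
  *-cancelˡ-invertible {a} {b} {x} {y} ab≈1 ax≈ay = begin
    x           ≈⟨ sym (*-identityˡ x) ⟩
    1# * x      ≈⟨ *-congʳ (sym ba≈1) ⟩
    b * a * x   ≈⟨ *-assoc b a x ⟩
    b * (a * x) ≈⟨ *-congˡ ax≈ay ⟩
    b * (a * y) ≈⟨ sym (*-assoc b a y) ⟩
    b * a * y   ≈⟨ *-congʳ ba≈1 ⟩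
    1# * y      ≈⟨ *-identityˡ y ⟩
    y           ∎
    where ba≈1 = trans (*-comm b a) ab≈1

  sumFromTo-pull-pow : ∀ x k n (f g : ℕ → Carrier) →
    sumFromTo k n (λ i → f i * pow x i * g i)
      ≈ pow x k * sumFromTo k n (λ i → pow x (i ∸ k) * f i * g i)
  sumFromTo-pull-pow x k n f g =
    trans (sumFromTo-cong k n term) (sym (*-distribˡ-sumUpTo (pow x k) (n ∸ k) _))
    where
    term : ∀ i → k ≤ i → f i * pow x i * g i ≈ pow x k * (pow x (i ∸ k) * f i * g i)
    term i k≤i = begin
      f i * pow x i * g i                     ≈⟨ *-congʳ (*-congˡ (pow-split x k≤i)) ⟩
      f i * (pow x k * pow x (i ∸ k)) * g i   ≈⟨ *-congʳ (*-comm _ _) ⟩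
      pow x k * pow x (i ∸ k) * f i * g i     ≈⟨ *-congʳ (*-assoc _ _ _) ⟩
      pow x k * (pow x (i ∸ k) * f i) * g i   ≈⟨ *-assoc _ _ _ ⟩
      pow x k * (pow x (i ∸ k) * f i * g i)   ∎

  sumP-apply : ∀ n (f : ℕ → Poly) j → sumP n f j ≈ sumUpTo n (λ k → f k j)
  sumP-apply zero    f j = refl
  sumP-apply (suc n) f j = +-congʳ (sumP-apply n f j)

  genFall-coeff-above : ∀ α k j → k < j → genFall α k j ≈ 0#
  genFall-coeff-above α zero    (suc j) _         = refl
  genFall-coeff-above α (suc k) (suc j) (s≤s k<j) = begin
    1# * genFall α k j + - α k * genFall α k (suc j)
      ≈⟨ +-cong (*-congˡ (genFall-coeff-above α k j k<j))
                (*-congˡ (genFall-coeff-above α k (suc j) (m<n⇒m<1+n k<j))) ⟩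
    1# * 0# + - α k * 0#   ≈⟨ +-cong (zeroʳ _) (zeroʳ _) ⟩
    0# + 0#                ≈⟨ +-identityʳ 0# ⟩
    0#                     ∎

  genFall-monic : ∀ α k → genFall α k k ≈ 1#
  genFall-monic α zero    = refl
  genFall-monic α (suc k) = begin
    1# * genFall α k k + - α k * genFall α k (suc k)
      ≈⟨ +-cong (*-congˡ (genFall-monic α k)) (*-congˡ (genFall-coeff-above α k (suc k) ≤-refl)) ⟩
    1# * 1# + - α k * 0#   ≈⟨ +-cong (*-identityˡ 1#) (zeroʳ _) ⟩
    1# + 0#                ≈⟨ +-identityʳ 1# ⟩
    1#                     ∎

  genFallCombination : (ℕ → Carrier) → ℕ → (ℕ → Carrier) → Poly
  genFallCombination α n c = sumP n (λ k → scaleP (c k) (genFall α k))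

  genFallCombination-coeff-above : ∀ α n c j → n < j → genFallCombination α n c j ≈ 0#
  genFallCombination-coeff-above α zero    c j n<j =
    trans (*-congˡ (genFall-coeff-above α 0 j n<j)) (zeroʳ _)
  genFallCombination-coeff-above α (suc n) c j n<j = begin
    genFallCombination α n c j + c (suc n) * genFall α (suc n) j
      ≈⟨ +-cong (genFallCombination-coeff-above α n c j (<-trans ≤-refl n<j))
                (*-congˡ (genFall-coeff-above α (suc n) j n<j)) ⟩
    0# + c (suc n) * 0#   ≈⟨ +-identityˡ _ ⟩
    c (suc n) * 0#        ≈⟨ zeroʳ _ ⟩
    0#                    ∎

  genFallCombination-leading : ∀ α n c → genFallCombination α n c n ≈ c n
  genFallCombination-leading α zero    c = trans (*-congˡ (genFall-monic α 0)) (*-identityʳ _)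
  genFallCombination-leading α (suc n) c = begin
    genFallCombination α n c (suc n) + c (suc n) * genFall α (suc n) (suc n)
      ≈⟨ +-cong (genFallCombination-coeff-above α n c (suc n) ≤-refl)
                (*-congˡ (genFall-monic α (suc n))) ⟩
    0# + c (suc n) * 1#   ≈⟨ +-identityˡ _ ⟩
    c (suc n) * 1#        ≈⟨ *-identityʳ _ ⟩
    c (suc n)             ∎

  genFallCombination-leading-unique : ∀ α n c d →
    genFallCombination α n c ≈ₚ genFallCombination α n d → c n ≈ d n
  genFallCombination-leading-unique α n c d c≈d =
    trans (sym (genFallCombination-leading α n c))
          (trans (c≈d n) (genFallCombination-leading α n d))

  genFallCombination-injective : ∀ α n c d →
    genFallCombination α n c ≈ₚ genFallCombination α n d → ∀ k → k ≤ n → c k ≈ d k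
  genFallCombination-injective α n c d c≈d k k≤n with m≤n⇒m<n∨m≡n k≤n
  ... | inj₂ ≡.refl = genFallCombination-leading-unique α k c d c≈d
  genFallCombination-injective α (suc n) c d c≈d k _ | inj₁ (s≤s k≤n) =
    genFallCombination-injective α n c d lower≈ k k≤n
    where
    lower≈ : genFallCombination α n c ≈ₚ genFallCombination α n d
    lower≈ j = ∙-cancelʳ _ _ _
      (trans (c≈d j) (+-congˡ (*-congʳ (sym (genFallCombination-leading-unique α (suc n) c d c≈d)))))

  genFallCombination-rebase : ∀ α β (S : ℕ → ℕ → Carrier) →
    (∀ i → genFall α i ≈ₚ genFallCombination β i (S i)) →
    ∀ n a → genFallCombination α n a
              ≈ₚ genFallCombination β n (λ k → sumFromTo k n (λ i → a i * S i k))
  genFallCombination-rebase α β S α-in-β n a j = begin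
    genFallCombination α n a j
      ≈⟨ sumP-apply n _ j ⟩
    sumUpTo n (λ i → a i * genFall α i j)
      ≈⟨ sumUpTo-cong n (λ i _ → *-congˡ (trans (α-in-β i j) (sumP-apply i _ j))) ⟩
    sumUpTo n (λ i → a i * sumUpTo i (λ k → S i k * genFall β k j))
      ≈⟨ sumUpTo-cong n (λ i _ → *-distribˡ-sumUpTo (a i) i _) ⟩
    sumUpTo n (λ i → sumUpTo i (λ k → a i * (S i k * genFall β k j)))
      ≈⟨ sumUpTo-triangle n _ ⟩
    sumUpTo n (λ k → sumFromTo k n (λ i → a i * (S i k * genFall β k j)))
      ≈⟨ sumUpTo-cong n (λ k _ → sumUpTo-cong (n ∸ k) (λ _ _ → sym (*-assoc _ _ _))) ⟩
    sumUpTo n (λ k → sumFromTo k n (λ i → a i * S i k * genFall β k j))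
      ≈⟨ sumUpTo-cong n (λ k _ → sym (*-distribʳ-sumUpTo _ (n ∸ k) _)) ⟩
    sumUpTo n (λ k → sumFromTo k n (λ i → a i * S i k) * genFall β k j)
      ≈⟨ sym (sumP-apply n _ j) ⟩
    genFallCombination β n (λ k → sumFromTo k n (λ i → a i * S i k)) j ∎

mainTheorem11 : ∀ {c ℓ} (R : CommutativeRing c ℓ) →
    let open CommutativeRing R hiding (zero)
        open Over R
    in IsField →
       (m r : Carrier) → ¬ (m ≈ 0#) →
       (α : ℕ → Carrier) →
       (W Wα S : ℕ → ℕ → Carrier) →
       IsRWhitney2 m r W →
       IsGenRWhitney2 m r α Wα →
       IsMultiStirling2 α S →
       ∀ n k → k ≤ n →
       W n k ≈ sumFromTo k n (λ i → pow m (i ∸ k) * Wα n i * S i k)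
mainTheorem11 R (_ , invertible) m r m≉0 α W Wα S isW isWα isS n k k≤n =
  *-cancelˡ-invertible R (pow-inverse R k (proj₂ (invertible m m≉0))) (begin
    pow m k * W n k
      ≈⟨ *-comm _ _ ⟩
    W n k * pow m k
      ≈⟨ genFallCombination-injective R natR n _ _ twoExpansions k k≤n ⟩
    sumFromTo k n (λ i → Wα n i * pow m i * S i k)
      ≈⟨ sumFromTo-pull-pow R m k n (Wα n) (λ i → S i k) ⟩
    pow m k * sumFromTo k n (λ i → pow m (i ∸ k) * Wα n i * S i k) ∎)
  where
  open CommutativeRing R hiding (zero)
  open Over R
  open SetoidReasoning setoid
  twoExpansions : genFallCombination R natR n (λ i → W n i * pow m i)
    ≈ₚ genFallCombination R natR n (λ k → sumFromTo k n (λ i → Wα n i * pow m i * S i k))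
  twoExpansions j = trans (sym (isW n j))
    (trans (isWα n j) (genFallCombination-rebase R α natR S isS n (λ i → Wα n i * pow m i) j))
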